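{- For $n\geq 1$ let $[n]=\{1,\dots,n\}$ and \[A(n)=\{(a_i)_{i=1}^n\in [n]^n : a_i\geq i \text{ for all } i\in[n], \text{ and } a_m=a_i \text{ whenever } i\leq m\leq a_i\}.\] (1) $|A(n)|=2^{n-1}$. (2) Order $A(n)$ by $a\leq a'$ iff $a_i\leq a'_i$ for all $i\in[n]$, and for $k\geq 1$ let $A_k(n)=\{(a^{(1)},\dots,a^{(k)})\in A(n)^k : a^{(k)}\leq a^{(k-1)}\leq\cdots\leq a^{(1)}\}$. Then $|A_k(n)|=(k+1)^{n-1}$. -}

module Defs where

open import Data.Nat using (ℕ; zero; suc)
open import Data.Fin using (Fin; toℕ; _≤_; _≤?_; _≟_)
open import Data.Fin.Properties using (all?)
open import Data.Vec using (Vec; []; _∷_; lookup; toList)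
open import Data.List using (List; []; _∷_; map; concatMap; allFin; filter)
open import Data.List.Relation.Unary.Linked using (Linked; linked?)
open import Data.Product using (_×_)
open import Relation.Binary.PropositionalEquality using (_≡_)
open import Relation.Nullary using (Dec; yes; no)
open import Relation.Nullary.Decidable using (_×-dec_; _→-dec_)

-- Convention: [n] = {1,…,n} is represented by Fin n = {0,…,n-1}
-- (shift by one; the conditions a_i ≥ i and i ≤ m ≤ a_i are shift-invariant).

vecsOf : ∀ {a} {X : Set a} → List X → (k : ℕ) → List (Vec X k)
vecsOf xs zero    = [] ∷ []
vecsOf xs (suc k) = concatMap (λ x → map (x ∷_) (vecsOf xs k)) xs

IsA : {n : ℕ} → Vec (Fin n) n → Set
IsA {n} a =
  ((i : Fin n) → i ≤ lookup a i) ×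
  ((i m : Fin n) → i ≤ m → m ≤ lookup a i → lookup a m ≡ lookup a i)

isA? : {n : ℕ} → (a : Vec (Fin n) n) → Dec (IsA a)
isA? a =
  all? (λ i → i ≤? lookup a i) ×-dec
  all? (λ i → all? (λ m → (i ≤? m) →-dec ((m ≤? lookup a i) →-dec (lookup a m ≟ lookup a i))))

listA : (n : ℕ) → List (Vec (Fin n) n)
listA n = filter isA? (vecsOf (allFin n) n)

_≤A_ : {n : ℕ} → Vec (Fin n) n → Vec (Fin n) n → Set
_≤A_ {n} a a′ = (i : Fin n) → lookup a i ≤ lookup a′ i

_≤A?_ : {n : ℕ} → (a a′ : Vec (Fin n) n) → Dec (a ≤A a′)
a ≤A? a′ = all? (λ i → lookup a i ≤? lookup a′ i)

IsChain : {n k : ℕ} → Vec (Vec (Fin n) n) k → Set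
IsChain v = Linked (λ x y → y ≤A x) (toList v)

isChain? : {n k : ℕ} → (v : Vec (Vec (Fin n) n) k) → Dec (IsChain v)
isChain? v = linked? (λ x y → y ≤A? x) (toList v)

listAk : (n k : ℕ) → List (Vec (Vec (Fin n) n) k)
listAk n k = filter isChain? (vecsOf (listA n) k)

{-# OPTIONS --safe #-}

-- Read a ∈ A(n) as a partition of [n] into intervals, a_i being the largest element of the
-- block of i. Deleting the element 1 is a bijection A(n + 1) ≅ Bool × A(n), the bit recording
-- whether {1} is a block, and a ≤ a′ holds iff the shortened sequences compare and {1} is a
-- block of a whenever it is one of a′. So a chain a⁽ᵏ⁾ ≤ … ≤ a⁽¹⁾ in A(n + 1) splits into a
-- chain in A(n) and a monotone column of k bits, i.e. a number in {0, …, k}; iterating,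
-- A_k(n + 1) ≅ {0, …, k}ⁿ, and (1) is the case k = 1.

module Submission where

open import Defs
open import Data.Nat using (ℕ; _≤_; _+_; _∸_; _^_)
open import Data.List using (length)
open import Data.Product using (_×_)
open import Relation.Binary.PropositionalEquality using (_≡_)

open import Data.Nat as ℕ using (zero; suc; _*_; z≤n; s≤s; s≤s⁻¹)
open import Data.Nat.Properties using (≤-trans; *-identityʳ; +-comm)
open import Data.Bool as Bool using (Bool; true; false; b≤b; f≤t)
open import Data.Bool.Properties using (≤-minimum)
open import Data.Fin as Fin using (Fin; toℕ) renaming (zero to fzero; suc to fsuc)
open import Data.Fin.Properties using (suc-injective)
open import Data.Vec as Vec using (Vec; []; _∷_; lookup; toList; replicate; zipWith)
open import Data.Vec.Properties using (lookup-map; map-∘; map-id; ∷-injective)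
import Data.Vec.Relation.Unary.All as VecAll
import Data.Vec.Relation.Unary.All.Properties as VecAll
open import Data.List as List using (List; []; _∷_; _++_; allFin; filter; cartesianProductWith)
open import Data.List.Properties using (length-++; length-map; length-tabulate; filter-all)
import Data.List.Relation.Unary.All as ListAll
import Data.List.Relation.Unary.AllPairs as AllPairs
open import Data.List.Relation.Unary.Linked as Linked using (Linked; []; [-]; _∷_)
open import Data.List.Relation.Unary.Any using (here)
open import Data.List.Membership.Propositional using (_∈_)
open import Data.List.Membership.Propositional.Properties
  using (∈-map⁺; ∈-map⁻; ∈-filter⁺; ∈-filter⁻; ∈-allFin;
         ∈-cartesianProductWith⁺; ∈-cartesianProductWith⁻)
open import Data.List.Membership.Propositional.Properties.WithK using (unique∧set⇒bag)
open import Data.List.Relation.Unary.Unique.Propositional using (Unique)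
import Data.List.Relation.Unary.Unique.Propositional.Properties as Unique
open import Data.List.Relation.Binary.BagAndSetEquality using (∼bag⇒↭)
open import Data.List.Relation.Binary.Permutation.Propositional.Properties using (↭-length)
open import Data.Product using (_,_; proj₁; proj₂; uncurry)
open import Function.Base using (_∘_)
open import Function.Bundles using (mk⇔)
open import Relation.Binary.PropositionalEquality
  using (refl; sym; trans; cong; cong₂; subst; module ≡-Reasoning)

module _ {X : Set} where

  vecsOf-suc : ∀ (xs : List X) k →
    vecsOf xs (suc k) ≡ cartesianProductWith _∷_ xs (vecsOf xs k)
  vecsOf-suc xs k = go xs
    where
    go : ∀ zs → List.concatMap (λ x → List.map (x ∷_) (vecsOf xs k)) zs
              ≡ cartesianProductWith _∷_ zs (vecsOf xs k)
    go [] = refl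
    go (z ∷ zs) = cong (List.map (z ∷_) (vecsOf xs k) ++_) (go zs)

  ∈-vecsOf⁺ : ∀ {xs : List X} {k} {v : Vec X k} → VecAll.All (_∈ xs) v → v ∈ vecsOf xs k
  ∈-vecsOf⁺ VecAll.[] = here refl
  ∈-vecsOf⁺ {xs} {suc k} (x∈xs VecAll.∷ v⊆xs) =
    subst (_ ∈_) (sym (vecsOf-suc xs k))
      (∈-cartesianProductWith⁺ _∷_ x∈xs (∈-vecsOf⁺ v⊆xs))

  ∈-vecsOf⁻ : ∀ {xs : List X} {k} {v : Vec X k} → v ∈ vecsOf xs k → VecAll.All (_∈ xs) v
  ∈-vecsOf⁻ {v = []} _ = VecAll.[]
  ∈-vecsOf⁻ {xs} {suc k} {x ∷ v} x∷v∈
    with _ , _ , x∈xs , v∈ , refl ←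
      ∈-cartesianProductWith⁻ _∷_ xs (vecsOf xs k) (subst (_ ∈_) (vecsOf-suc xs k) x∷v∈)
    = x∈xs VecAll.∷ ∈-vecsOf⁻ v∈

  length-cartesianProductWith : ∀ {Y Z : Set} (f : X → Y → Z) xs ys →
    length (cartesianProductWith f xs ys) ≡ length xs * length ys
  length-cartesianProductWith f [] ys = refl
  length-cartesianProductWith f (x ∷ xs) ys = begin
    length (List.map (f x) ys ++ cartesianProductWith f xs ys)
      ≡⟨ length-++ (List.map (f x) ys) ⟩
    length (List.map (f x) ys) + length (cartesianProductWith f xs ys)
      ≡⟨ cong₂ _+_ (length-map (f x) ys) (length-cartesianProductWith f xs ys) ⟩
    length ys + length xs * length ys
      ∎
    where open ≡-Reasoning

  length-vecsOf : ∀ (xs : List X) k → length (vecsOf xs k) ≡ length xs ^ k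
  length-vecsOf xs zero = refl
  length-vecsOf xs (suc k) = begin
    length (vecsOf xs (suc k))
      ≡⟨ cong length (vecsOf-suc xs k) ⟩
    length (cartesianProductWith _∷_ xs (vecsOf xs k))
      ≡⟨ length-cartesianProductWith _∷_ xs (vecsOf xs k) ⟩
    length xs * length (vecsOf xs k)
      ≡⟨ cong (length xs *_) (length-vecsOf xs k) ⟩
    length xs * length xs ^ k
      ∎
    where open ≡-Reasoning

  vecsOf⁺ : ∀ {xs : List X} k → Unique xs → Unique (vecsOf xs k)
  vecsOf⁺ zero _ = ListAll.[] AllPairs.∷ AllPairs.[]
  vecsOf⁺ {xs} (suc k) xs! =
    subst Unique (sym (vecsOf-suc xs k))
      (Unique.cartesianProductWith⁺ _∷_ ∷-injective xs! (vecsOf⁺ k xs!))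

length-≡-by-inverse : ∀ {A B : Set} {xs : List A} {ys : List B} (f : B → A) (g : A → B) →
  Unique xs → Unique ys → (∀ b → b ∈ ys) → (∀ b → g (f b) ≡ b) →
  (∀ b → f b ∈ xs) → (∀ {a} → a ∈ xs → f (g a) ≡ a) → length xs ≡ length ys
length-≡-by-inverse {xs = xs} {ys} f g xs! ys! ∈ys g∘f≡id f∈xs f∘g≡id = begin
  length xs              ≡⟨ ↭-length (∼bag⇒↭ (unique∧set⇒bag xs! fys! (mk⇔ to from))) ⟩
  length (List.map f ys) ≡⟨ length-map f ys ⟩
  length ys              ∎
  where
  open ≡-Reasoning
  f-injective : ∀ {b b′} → f b ≡ f b′ → b ≡ b′
  f-injective {b} {b′} fb≡fb′ = trans (sym (g∘f≡id b)) (trans (cong g fb≡fb′) (g∘f≡id b′))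
  fys! : Unique (List.map f ys)
  fys! = Unique.map⁺ f-injective ys!
  to : ∀ {a} → a ∈ xs → a ∈ List.map f ys
  to {a} a∈xs = subst (_∈ List.map f ys) (f∘g≡id a∈xs) (∈-map⁺ f (∈ys (g a)))
  from : ∀ {a} → a ∈ List.map f ys → a ∈ xs
  from a∈fys with _ , _ , refl ← ∈-map⁻ f a∈fys = f∈xs _

Ascending : ∀ {k} → Vec Bool k → Set
Ascending c = Linked Bool._≤_ (toList c)

threshold : ∀ {k} → Fin (suc k) → Vec Bool k
threshold {k} fzero = replicate k true
threshold {suc k} (fsuc l) = false ∷ threshold l

countFalse : ∀ {k} → Vec Bool k → Fin (suc k)
countFalse [] = fzero
countFalse (true ∷ _) = fzero
countFalse (false ∷ c) = fsuc (countFalse c)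

countFalse-threshold : ∀ {k} (l : Fin (suc k)) → countFalse (threshold l) ≡ l
countFalse-threshold {zero} fzero = refl
countFalse-threshold {suc k} fzero = refl
countFalse-threshold {suc k} (fsuc l) = cong fsuc (countFalse-threshold l)

replicate-true-ascending : ∀ k → Ascending (replicate k true)
replicate-true-ascending zero = []
replicate-true-ascending (suc zero) = [-]
replicate-true-ascending (suc (suc k)) = b≤b ∷ replicate-true-ascending (suc k)

false-∷-ascending : ∀ {k} (c : Vec Bool k) → Ascending c → Ascending (false ∷ c)
false-∷-ascending [] _ = [-]
false-∷-ascending (b ∷ _) c↑ = ≤-minimum b ∷ c↑

threshold-ascending : ∀ {k} (l : Fin (suc k)) → Ascending (threshold l)
threshold-ascending {k} fzero = replicate-true-ascending k
threshold-ascending {suc k} (fsuc l) = false-∷-ascending (threshold l) (threshold-ascending l)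

threshold-countFalse : ∀ {k} (c : Vec Bool k) → Ascending c → threshold (countFalse c) ≡ c
threshold-countFalse [] _ = refl
threshold-countFalse (true ∷ c) c↑ = cong (true ∷_) (all-true c c↑)
  where
  all-true : ∀ {k} (c : Vec Bool k) → Ascending (true ∷ c) → replicate k true ≡ c
  all-true [] _ = refl
  all-true (true ∷ c) (_ ∷ c↑) = cong (true ∷_) (all-true c c↑)
  all-true (false ∷ c) (() ∷ _)
threshold-countFalse (false ∷ c) c↑ =
  cong (false ∷_) (threshold-countFalse c (Linked.tail c↑))

Seq : ℕ → Set
Seq n = Vec (Fin n) n

extend : ∀ {m} → Bool → Seq (suc m) → Seq (suc (suc m))
extend true t = fzero ∷ Vec.map fsuc t
extend false t = fsuc (lookup t fzero) ∷ Vec.map fsuc t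

headIsZero : ∀ {m} → Seq (suc (suc m)) → Bool
headIsZero (fzero ∷ _) = true
headIsZero (fsuc _ ∷ _) = false

-- predFin fzero = fzero is a junk value: tailA only meets the entries a₂, …, aₙ of elements
-- of A, which are positive.
predFin : ∀ {m} → Fin (suc (suc m)) → Fin (suc m)
predFin fzero = fzero
predFin (fsuc i) = i

tailA : ∀ {m} → Seq (suc (suc m)) → Seq (suc m)
tailA (_ ∷ xs) = Vec.map predFin xs

lookup-extend : ∀ {m} b (t : Seq (suc m)) i → lookup (extend b t) (fsuc i) ≡ fsuc (lookup t i)
lookup-extend true t i = lookup-map i fsuc t
lookup-extend false t i = lookup-map i fsuc t

headIsZero-extend : ∀ {m} b (t : Seq (suc m)) → headIsZero (extend b t) ≡ b
headIsZero-extend true _ = refl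
headIsZero-extend false _ = refl

tailA-extend : ∀ {m} b (t : Seq (suc m)) → tailA (extend b t) ≡ t
tailA-extend true t = trans (sym (map-∘ predFin fsuc t)) (map-id t)
tailA-extend false t = trans (sym (map-∘ predFin fsuc t)) (map-id t)

map-suc-predFin : ∀ {m p} (xs : Vec (Fin (suc (suc m))) p) → (∀ i → 0 ℕ.< toℕ (lookup xs i)) →
  Vec.map fsuc (Vec.map predFin xs) ≡ xs
map-suc-predFin [] _ = refl
map-suc-predFin (fzero ∷ xs) xs>0 with xs>0 fzero
... | ()
map-suc-predFin (fsuc x ∷ xs) xs>0 = cong (fsuc x ∷_) (map-suc-predFin xs (xs>0 ∘ fsuc))

extend-headIsZero-tailA : ∀ {m} {a : Seq (suc (suc m))} → IsA a →
  extend (headIsZero a) (tailA a) ≡ a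
extend-headIsZero-tailA {a = fzero ∷ xs} (above , _) =
  cong (fzero ∷_) (map-suc-predFin xs (λ i → ≤-trans (s≤s z≤n) (above (fsuc i))))
extend-headIsZero-tailA {a = fsuc x ∷ xs@(_ ∷ _)} (above , blocks) =
  cong₂ _∷_ (cong (fsuc ∘ predFin) (blocks fzero (fsuc fzero) z≤n (s≤s z≤n)))
            (map-suc-predFin xs (λ i → ≤-trans (s≤s z≤n) (above (fsuc i))))

IsA-extend : ∀ {m} b {t : Seq (suc m)} → IsA t → IsA (extend b t)
IsA-extend b {t} (t-above , t-blocks) = above b , blocks b
  where
  above : ∀ c i → i Fin.≤ lookup (extend c t) i
  above c fzero = z≤n
  above c (fsuc i) rewrite lookup-extend c t i = s≤s (t-above i)
  blocks : ∀ c i j → i Fin.≤ j → j Fin.≤ lookup (extend c t) i →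
           lookup (extend c t) j ≡ lookup (extend c t) i
  blocks c fzero fzero _ _ = refl
  blocks true fzero (fsuc j) _ ()
  blocks false fzero (fsuc j) _ j≤a₀ rewrite lookup-extend false t j =
    cong fsuc (t-blocks fzero j z≤n (s≤s⁻¹ j≤a₀))
  blocks c (fsuc i) (fsuc j) i≤j j≤aᵢ rewrite lookup-extend c t i | lookup-extend c t j =
    cong fsuc (t-blocks i j (s≤s⁻¹ i≤j) (s≤s⁻¹ j≤aᵢ))

IsA-extend⁻ : ∀ {m} b {t : Seq (suc m)} → IsA (extend b t) → IsA t
IsA-extend⁻ b {t} (a-above , a-blocks) = above , blocks
  where
  above : ∀ i → i Fin.≤ lookup t i
  above i with a-above (fsuc i)
  ... | i<aᵢ rewrite lookup-extend b t i = s≤s⁻¹ i<aᵢ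
  blocks : ∀ i j → i Fin.≤ j → j Fin.≤ lookup t i → lookup t j ≡ lookup t i
  blocks i j i≤j j≤tᵢ with a-blocks (fsuc i) (fsuc j) (s≤s i≤j)
  ... | block rewrite lookup-extend b t i | lookup-extend b t j = suc-injective (block (s≤s j≤tᵢ))

IsA-tailA : ∀ {m} {a : Seq (suc (suc m))} → IsA a → IsA (tailA a)
IsA-tailA {a = a} a∈A =
  IsA-extend⁻ (headIsZero a) {tailA a} (subst IsA (sym (extend-headIsZero-tailA {a = a} a∈A)) a∈A)

extend-mono : ∀ {m b b′} {t t′ : Seq (suc m)} → b Bool.≤ b′ → t′ ≤A t →
  extend b′ t′ ≤A extend b t
extend-mono {b′ = true} _ _ fzero = z≤n
extend-mono {b = false} {false} _ t′≤t fzero = s≤s (t′≤t fzero)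
extend-mono {b = true} {false} () _ fzero
extend-mono {b = b} {b′} {t} {t′} _ t′≤t (fsuc i)
  rewrite lookup-extend b′ t′ i | lookup-extend b t i = s≤s (t′≤t i)

extend-mono⁻ : ∀ {m} b b′ {t t′ : Seq (suc m)} → extend b′ t′ ≤A extend b t →
  b Bool.≤ b′ × t′ ≤A t
extend-mono⁻ b b′ {t} {t′} a′≤a = heads b b′ (a′≤a fzero) , tails
  where
  heads : ∀ c c′ → lookup (extend c′ t′) fzero Fin.≤ lookup (extend c t) fzero → c Bool.≤ c′
  heads true true _ = b≤b
  heads false true _ = f≤t
  heads false false _ = b≤b
  heads true false ()
  tails : t′ ≤A t
  tails i with a′≤a (fsuc i)
  ... | a′ᵢ≤aᵢ rewrite lookup-extend b′ t′ i | lookup-extend b t i = s≤s⁻¹ a′ᵢ≤aᵢ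

map-headIsZero-zipWith-extend : ∀ {k m} (c : Vec Bool k) (r : Vec (Seq (suc m)) k) →
  Vec.map headIsZero (zipWith extend c r) ≡ c
map-headIsZero-zipWith-extend [] [] = refl
map-headIsZero-zipWith-extend (b ∷ c) (t ∷ r) =
  cong₂ _∷_ (headIsZero-extend b t) (map-headIsZero-zipWith-extend c r)

map-tailA-zipWith-extend : ∀ {k m} (c : Vec Bool k) (r : Vec (Seq (suc m)) k) →
  Vec.map tailA (zipWith extend c r) ≡ r
map-tailA-zipWith-extend [] [] = refl
map-tailA-zipWith-extend (b ∷ c) (t ∷ r) =
  cong₂ _∷_ (tailA-extend b t) (map-tailA-zipWith-extend c r)

zipWith-extend-headIsZero-tailA : ∀ {k m} {v : Vec (Seq (suc (suc m))) k} →
  VecAll.All IsA v → zipWith extend (Vec.map headIsZero v) (Vec.map tailA v) ≡ v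
zipWith-extend-headIsZero-tailA VecAll.[] = refl
zipWith-extend-headIsZero-tailA (a∈A VecAll.∷ v⊆A) =
  cong₂ _∷_ (extend-headIsZero-tailA a∈A) (zipWith-extend-headIsZero-tailA v⊆A)

All-IsA-zipWith-extend : ∀ {k m} (c : Vec Bool k) {r : Vec (Seq (suc m)) k} →
  VecAll.All IsA r → VecAll.All IsA (zipWith extend c r)
All-IsA-zipWith-extend [] VecAll.[] = VecAll.[]
All-IsA-zipWith-extend (b ∷ c) (t∈A VecAll.∷ r⊆A) =
  IsA-extend b t∈A VecAll.∷ All-IsA-zipWith-extend c r⊆A

IsChain-zipWith-extend⁺ : ∀ {k m} {c : Vec Bool k} {r : Vec (Seq (suc m)) k} →
  Ascending c → IsChain r → IsChain (zipWith extend c r)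
IsChain-zipWith-extend⁺ {c = []} {[]} _ _ = []
IsChain-zipWith-extend⁺ {c = _ ∷ []} {_ ∷ []} _ _ = [-]
IsChain-zipWith-extend⁺ {c = _ ∷ _ ∷ _} {_ ∷ _ ∷ _} (b≤b′ ∷ c↑) (t′≤t ∷ r-chain) =
  extend-mono b≤b′ t′≤t ∷ IsChain-zipWith-extend⁺ c↑ r-chain

IsChain-zipWith-extend⁻ : ∀ {k m} (c : Vec Bool k) (r : Vec (Seq (suc m)) k) →
  IsChain (zipWith extend c r) → Ascending c × IsChain r
IsChain-zipWith-extend⁻ [] [] _ = [] , []
IsChain-zipWith-extend⁻ (_ ∷ []) (_ ∷ []) _ = [-] , [-]
IsChain-zipWith-extend⁻ (b ∷ b′ ∷ c) (t ∷ t′ ∷ r) (a′≤a ∷ chain)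
  with b≤b′ , t′≤t ← extend-mono⁻ b b′ a′≤a
     | c↑ , r-chain ← IsChain-zipWith-extend⁻ (b′ ∷ c) (t′ ∷ r) chain
  = b≤b′ ∷ c↑ , t′≤t ∷ r-chain

decode : ∀ {k m} → Vec (Fin (suc k)) m → Vec (Seq (suc m)) k
decode {k} [] = replicate k (fzero ∷ [])
decode (l ∷ ℓ) = zipWith extend (threshold l) (decode ℓ)

-- Entry i counts the members a of the chain with a_i ≠ i, i.e. in which i does not end its block.
encode : ∀ {k m} → Vec (Seq (suc m)) k → Vec (Fin (suc k)) m
encode {m = zero} _ = []
encode {m = suc m} v = countFalse (Vec.map headIsZero v) ∷ encode (Vec.map tailA v)

encode-decode : ∀ {k m} (ℓ : Vec (Fin (suc k)) m) → encode (decode ℓ) ≡ ℓ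
encode-decode [] = refl
encode-decode (l ∷ ℓ) = cong₂ _∷_
  (trans (cong countFalse (map-headIsZero-zipWith-extend (threshold l) (decode ℓ)))
         (countFalse-threshold l))
  (trans (cong encode (map-tailA-zipWith-extend (threshold l) (decode ℓ)))
         (encode-decode ℓ))

decode-IsA : ∀ {k m} (ℓ : Vec (Fin (suc k)) m) → VecAll.All IsA (decode ℓ)
decode-IsA [] = VecAll.universal IsA₁ _
  where
  IsA₁ : (a : Seq 1) → IsA a
  IsA₁ (fzero ∷ []) = (λ { fzero → z≤n }) , (λ { fzero fzero _ _ → refl })
decode-IsA (l ∷ ℓ) = All-IsA-zipWith-extend (threshold l) (decode-IsA ℓ)

decode-IsChain : ∀ {k m} (ℓ : Vec (Fin (suc k)) m) → IsChain (decode ℓ)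
decode-IsChain {k} [] = replicate-IsChain k
  where
  replicate-IsChain : ∀ k → IsChain (replicate k (fzero ∷ []))
  replicate-IsChain zero = []
  replicate-IsChain (suc zero) = [-]
  replicate-IsChain (suc (suc k)) = (λ { fzero → z≤n }) ∷ replicate-IsChain (suc k)
decode-IsChain (l ∷ ℓ) = IsChain-zipWith-extend⁺ (threshold-ascending l) (decode-IsChain ℓ)

decode-encode : ∀ {k m} {v : Vec (Seq (suc m)) k} → VecAll.All IsA v → IsChain v →
  decode (encode v) ≡ v
decode-encode {m = zero} {v} _ _ = replicate-Seq₁ v
  where
  replicate-Seq₁ : ∀ {k} (v : Vec (Seq 1) k) → replicate k (fzero ∷ []) ≡ v
  replicate-Seq₁ [] = refl
  replicate-Seq₁ ((fzero ∷ []) ∷ v) = cong ((fzero ∷ []) ∷_) (replicate-Seq₁ v)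
decode-encode {m = suc m} {v} v⊆A v-chain = begin
  zipWith extend (threshold (countFalse c)) (decode (encode r))
    ≡⟨ cong₂ (zipWith extend) (threshold-countFalse c c↑) (decode-encode r⊆A r-chain) ⟩
  zipWith extend c r
    ≡⟨ v-split ⟩
  v ∎
  where
  open ≡-Reasoning
  c = Vec.map headIsZero v
  r = Vec.map tailA v
  v-split : zipWith extend c r ≡ v
  v-split = zipWith-extend-headIsZero-tailA v⊆A
  c↑ : Ascending c
  c↑ = proj₁ (IsChain-zipWith-extend⁻ c r (subst IsChain (sym v-split) v-chain))
  r-chain : IsChain r
  r-chain = proj₂ (IsChain-zipWith-extend⁻ c r (subst IsChain (sym v-split) v-chain))
  r⊆A : VecAll.All IsA r
  r⊆A = VecAll.map⁺ (VecAll.map (λ {a} → IsA-tailA {a = a}) v⊆A)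

∈-listA⁺ : ∀ {n} {a : Seq n} → IsA a → a ∈ listA n
∈-listA⁺ {a = a} a∈A = ∈-filter⁺ isA? (∈-vecsOf⁺ (VecAll.universal ∈-allFin a)) a∈A

∈-listA⁻ : ∀ {n} {a : Seq n} → a ∈ listA n → IsA a
∈-listA⁻ {n} a∈ = proj₂ (∈-filter⁻ isA? {xs = vecsOf (allFin n) n} a∈)

∈-listAk⁺ : ∀ {n k} {v : Vec (Seq n) k} → VecAll.All IsA v → IsChain v → v ∈ listAk n k
∈-listAk⁺ v⊆A v-chain = ∈-filter⁺ isChain? (∈-vecsOf⁺ (VecAll.map ∈-listA⁺ v⊆A)) v-chain

∈-listAk⁻ : ∀ {n k} {v : Vec (Seq n) k} → v ∈ listAk n k → VecAll.All IsA v × IsChain v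
∈-listAk⁻ v∈ with v∈vecsOf , v-chain ← ∈-filter⁻ isChain? v∈ =
  VecAll.map ∈-listA⁻ (∈-vecsOf⁻ v∈vecsOf) , v-chain

listAk-unique : ∀ n k → Unique (listAk n k)
listAk-unique n k =
  Unique.filter⁺ isChain? (vecsOf⁺ k (Unique.filter⁺ isA? (vecsOf⁺ n (Unique.allFin⁺ n))))

length-listAk : ∀ m k → length (listAk (suc m) k) ≡ suc k ^ m
length-listAk m k = begin
  length (listAk (suc m) k)
    ≡⟨ length-≡-by-inverse decode encode
         (listAk-unique (suc m) k) (vecsOf⁺ m (Unique.allFin⁺ (suc k)))
         (λ ℓ → ∈-vecsOf⁺ (VecAll.universal ∈-allFin ℓ)) encode-decode
         (λ ℓ → ∈-listAk⁺ (decode-IsA ℓ) (decode-IsChain ℓ))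
         (λ v∈ → uncurry decode-encode (∈-listAk⁻ v∈)) ⟩
  length (vecsOf (allFin (suc k)) m) ≡⟨ length-vecsOf (allFin (suc k)) m ⟩
  length (allFin (suc k)) ^ m        ≡⟨ cong (_^ m) (length-tabulate (λ i → i)) ⟩
  suc k ^ m                          ∎
  where open ≡-Reasoning

length-listAk-1 : ∀ n → length (listAk n 1) ≡ length (listA n)
length-listAk-1 n = begin
  length (filter isChain? (vecsOf (listA n) 1))
    ≡⟨ cong length (filter-all isChain? (ListAll.universal singleton-chain (vecsOf (listA n) 1))) ⟩
  length (vecsOf (listA n) 1) ≡⟨ length-vecsOf (listA n) 1 ⟩
  length (listA n) * 1        ≡⟨ *-identityʳ (length (listA n)) ⟩
  length (listA n)            ∎
  where
  open ≡-Reasoning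
  singleton-chain : (v : Vec (Seq n) 1) → IsChain v
  singleton-chain (_ ∷ []) = [-]

lemma3p3 : ((n : ℕ) → 1 ≤ n → length (listA n) ≡ 2 ^ (n ∸ 1))
           × ((n k : ℕ) → 1 ≤ n → 1 ≤ k → length (listAk n k) ≡ (k + 1) ^ (n ∸ 1))
lemma3p3 = part₁ , part₂
  where
  part₁ : (n : ℕ) → 1 ≤ n → length (listA n) ≡ 2 ^ (n ∸ 1)
  part₁ (suc m) _ = trans (sym (length-listAk-1 (suc m))) (length-listAk m 1)
  part₂ : (n k : ℕ) → 1 ≤ n → 1 ≤ k → length (listAk n k) ≡ (k + 1) ^ (n ∸ 1)
  part₂ (suc m) k _ _ = trans (length-listAk m k) (cong (_^ m) (+-comm 1 k))
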